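{- Let $\{G_n=([n],E_n)\}$ be graphs such that each $G_n$ is $\gamma n$-robustly self-ordered for a constant $\gamma>0$, and let $\{H_m\}$ be a family of $D$-regular $\beta$-expanding $m$-vertex graphs for constants $D,\beta>0$. Let $G'_n$ be the multi-graph on vertex set $V=\bigcup_{v\in[n]}C_v$, where $C_v=\{\langle v,u\rangle:u\in[n]\setminus\{v\}\}$, whose edges are: a copy of $H_{n-1}$ on each $C_v$, with all these edges coloured $1$; and, for every pair $u\ne v$, the edge $\{\langle v,u\rangle,\langle u,v\rangle\}$, coloured $2$ if $\{u,v\}\in E_n$ and coloured $0$ otherwise. Let $\chi'$ be this colouring. Then there is a constant $\gamma'>0$ (independent of $n$) such that $(G'_n,\chi')$ is $\gamma'$-robustly self-ordered in the edge-coloured sense.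
   Context: For $\rho>0$, a graph $G=(V,E)$ is $\rho$-robustly self-ordered if for every permutation $\pi$ of $V$, $|E\triangle\{\{\pi(u),\pi(v)\}:\{u,v\}\in E\}|\ge\rho|\{v:\pi(v)\ne v\}|$. A graph is $\beta$-expanding if every vertex set $S$ of at most half the vertices has at least $\beta|S|$ outside vertices adjacent to $S$. Edge-coloured sense: for a coloured multi-graph with colour classes $E_i$ (multi-sets), it is $\gamma'$-robustly self-ordered if for every permutation $\mu$ of the vertices, $\sum_i|E_i\triangle\{\{\mu(u),\mu(v)\}:\{u,v\}\in E_i\}|\ge\gamma'|\{v:\mu(v)\ne v\}|$, where multi-set symmetric difference counts absolute differences of multiplicities. -}

module Defs where

open import Data.Bool using (Bool; true; false; if_then_else_; _∧_; _∨_; not)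
open import Data.Nat using (ℕ; zero; suc; _+_; _*_; _∸_; ∣_-_∣)
open import Data.Fin using (Fin; zero; suc; toℕ; punchIn; remQuot; _≟_)
open import Data.Fin.Permutation using (Permutation′; _⟨$⟩ʳ_; _⟨$⟩ˡ_)
open import Data.Fin.Subset using (Subset; _∈_; ∣_∣)
open import Data.Product using (_×_; _,_; proj₁; proj₂)
open import Data.Integer using (+_)
open import Data.Rational using (ℚ; _/_)
import Data.Rational as Q
open import Data.Vec using (lookup)
open import Relation.Nullary.Decidable using (⌊_⌋)
open import Relation.Binary.PropositionalEquality using (_≡_)
import Data.Nat as ℕ

Σ[<_] : ∀ n → (Fin n → ℕ) → ℕ
Σ[< zero ] f = 0
Σ[< suc n ] f = f zero + Σ[< n ] (λ i → f (suc i))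

count : ∀ {n} → (Fin n → Bool) → ℕ
count {n} p = Σ[< n ] (λ i → if p i then 1 else 0)

anyF : ∀ {n} → (Fin n → Bool) → Bool
anyF {zero} p = false
anyF {suc n} p = p zero ∨ anyF (λ i → p (suc i))

_==_ : ∀ {n} → Fin n → Fin n → Bool
x == y = ⌊ x ≟ y ⌋

_<ᵇF_ : ∀ {n} → Fin n → Fin n → Bool
x <ᵇF y = toℕ x ℕ.<ᵇ toℕ y

_≤ᵇF_ : ∀ {n} → Fin n → Fin n → Bool
x ≤ᵇF y = toℕ x ℕ.≤ᵇ toℕ y

_≠ᵇ_ : Bool → Bool → Bool
a ≠ᵇ b = if a then not b else b

toℚ : ℕ → ℚ
toℚ n = (+ n) / 1

record Graph (n : ℕ) : Set where
  field
    adj   : Fin n → Fin n → Bool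
    sym   : ∀ x y → adj x y ≡ adj y x
    irrefl : ∀ x → adj x x ≡ false
open Graph public

moved : ∀ {n} → Permutation′ n → ℕ
moved π = count (λ v → not ((π ⟨$⟩ʳ v) == v))

-- |E △ π(E)| : unordered pairs {x,y} (x < y) lying in exactly one of
-- E and π(E) = {{π u, π v} : {u,v} ∈ E}; {x,y} ∈ π(E) iff {π⁻¹x, π⁻¹y} ∈ E.
symDiff : ∀ {n} → Graph n → Permutation′ n → ℕ
symDiff {n} G π =
  Σ[< n ] λ x → Σ[< n ] λ y →
    if (x <ᵇF y) ∧ (adj G x y ≠ᵇ adj G (π ⟨$⟩ˡ x) (π ⟨$⟩ˡ y)) then 1 else 0

RobustlySelfOrdered : ∀ {n} → ℚ → Graph n → Set
RobustlySelfOrdered {n} ρ G =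
  (π : Permutation′ n) → ρ Q.* toℚ (moved π) Q.≤ toℚ (symDiff G π)

degree : ∀ {n} → Graph n → Fin n → ℕ
degree G v = count (λ w → adj G v w)

Regular : ∀ {n} → ℕ → Graph n → Set
Regular D G = ∀ v → degree G v ≡ D

outNeighbours : ∀ {n} → Graph n → Subset n → ℕ
outNeighbours G S =
  count (λ w → not (lookup S w) ∧ anyF (λ s → lookup S s ∧ adj G s w))

Expanding : ∀ {n} → ℚ → Graph n → Set
Expanding {n} β G =
  (S : Subset n) → 2 ℕ.* ∣ S ∣ ℕ.≤ n → β Q.* toℚ ∣ S ∣ Q.≤ toℚ (outNeighbours G S)

-- Edge-coloured multigraphs on Fin N with k colours:
-- mult i x y (for x ≤ y in the order of Fin) = multiplicity of the edge
-- {x,y} in the colour class E_i (a multiset). Values with x > y are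
-- ignored; multU reads the multiplicity of the unordered pair {x,y}.

record ColMultigraph (k N : ℕ) : Set where
  field
    mult : Fin k → Fin N → Fin N → ℕ
open ColMultigraph public

multU : ∀ {k N} → ColMultigraph k N → Fin k → Fin N → Fin N → ℕ
multU M i x y = if x ≤ᵇF y then mult M i x y else mult M i y x

-- Σ_i |E_i △ μ(E_i)| (multiset symmetric difference), summing over
-- unordered pairs {x,y} (x ≤ y, loops included) the absolute difference of
-- multiplicities; the multiplicity of {x,y} in μ(E_i) is that of {μ⁻¹x,μ⁻¹y}.
colSymDiff : ∀ {k N} → ColMultigraph k N → Permutation′ N → ℕ
colSymDiff {k} {N} M μ =
  Σ[< k ] λ i → Σ[< N ] λ x → Σ[< N ] λ y →
    if x ≤ᵇF y then ∣ multU M i x y - multU M i (μ ⟨$⟩ˡ x) (μ ⟨$⟩ˡ y) ∣ else 0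

ColRobustlySelfOrdered : ∀ {k N} → ℚ → ColMultigraph k N → Set
ColRobustlySelfOrdered {k} {N} γ' M =
  (μ : Permutation′ N) → γ' Q.* toℚ (moved μ) Q.≤ toℚ (colSymDiff M μ)

-- Vertex set V = ⋃_{v∈[n]} C_v, C_v = {⟨v,u⟩ : u ∈ [n]∖{v}}, encoded as
-- Fin (n * (n ∸ 1)): x decodes (remQuot) to (v , i) and stands for
-- ⟨v , member v i⟩, where member v : Fin (n ∸ 1) → [n]∖{v} is punchIn v.

member : ∀ n → Fin n → Fin (n ∸ 1) → Fin n
member (suc m) v i = punchIn v i

block : ∀ n → Fin (n * (n ∸ 1)) → Fin n
block n x = proj₁ (remQuot {n} (n ∸ 1) x)

index : ∀ n → Fin (n * (n ∸ 1)) → Fin (n ∸ 1)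
index n x = proj₂ (remQuot {n} (n ∸ 1) x)

-- the second coordinate u of x = ⟨v,u⟩
other : ∀ n → Fin (n * (n ∸ 1)) → Fin n
other n x = member n (block n x) (index n x)

-- Colours: 0, 1, 2 (Fin 3).
-- σ v identifies the vertex set Fin (n ∸ 1) of H_{n-1} with C_v: the
-- H-vertex a is placed at ⟨v , member v (σ v ⟨$⟩ʳ a)⟩ (an arbitrary copy).
G′ : ∀ n → Graph n → Graph (n ∸ 1) → (Fin n → Permutation′ (n ∸ 1))
     → ColMultigraph 3 (n * (n ∸ 1))
G′ n G H σ = record { mult = m }
  where
  cross : Fin (n * (n ∸ 1)) → Fin (n * (n ∸ 1)) → Bool
  cross x y = (other n x == block n y) ∧ (other n y == block n x)
  inner : Fin (n * (n ∸ 1)) → Fin (n * (n ∸ 1)) → Bool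
  inner x y = (block n x == block n y) ∧
    adj H (σ (block n x) ⟨$⟩ˡ index n x) (σ (block n y) ⟨$⟩ˡ index n y)
  b : Bool → ℕ
  b c = if c then 1 else 0
  m : Fin 3 → Fin (n * (n ∸ 1)) → Fin (n * (n ∸ 1)) → ℕ
  m zero x y = b (cross x y ∧ not (adj G (block n x) (block n y)))
  m (suc zero) x y = b (inner x y)
  m (suc (suc zero)) x y = b (cross x y ∧ adj G (block n x) (block n y))

{-# OPTIONS --safe #-}
module Submission where

-- Write τ = μ⁻¹ and label each vertex ⟨v,u⟩ of C_v by the block containing τ⟨v,u⟩. As H is an
-- expander, the labels on C_v disagree with a plurality label on at most O(1) times as many vertices as
-- there are colour-1 edges inside C_v with differently labelled ends, and each such edge is a colour-1
-- discrepancy of μ. Distinct blocks cannot share a strict-majority label (every block has n - 1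
-- vertices), so the plurality labels extend to a permutation ρ of [n]. A vertex moved by μ is then
-- misplaced (its label is not ρ v), lies in a block moved by ρ, or stays in its block as does its twin
-- ⟨u,v⟩, in which case the colour-0/2 edge between them is lost. Likewise each pair {u,v} on which
-- G and ρ(G) differ is witnessed at ⟨v,u⟩ by a misplaced vertex or a colour-0/2 discrepancy, so
-- robustness of G bounds the (n - 1)·|moved ρ| vertices of moved blocks by the same quantities.

open import Data.Bool using (Bool; true; false; if_then_else_; _∧_; _∨_; not; T)
import Data.Bool.Properties as Bool
open import Data.Nat using (ℕ; zero; suc; _+_; _≤_; z≤n; s≤s; ∣_-_∣; _∸_)
import Data.Nat as ℕ
import Data.Nat.Properties as ℕ
open import Data.Nat.Solver using (module +-*-Solver)
import Data.Rational as ℚ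
import Data.Rational.Properties as ℚ
open import Data.Fin as Fin using (Fin; zero; suc; toℕ; _≟_; punchIn; punchOut; combine; _↑ˡ_; _↑ʳ_)
import Data.Fin.Properties as Fin
open import Data.Fin.Patterns using (0F; 1F; 2F)
open import Data.Fin.Permutation as Perm using (Permutation′; _⟨$⟩ʳ_; _⟨$⟩ˡ_)
open import Data.Maybe using (Maybe; just; nothing)
open import Data.Product using (Σ; _×_; ∃-syntax; _,_; proj₁; proj₂)
open import Data.Sum using (_⊎_; inj₁; inj₂)
open import Data.Empty using (⊥; ⊥-elim)
open import Function using (_∘_; Equivalence)
open import Relation.Binary.PropositionalEquality
open import Relation.Nullary using (¬_; yes; no; Dec)
open import Defs hiding (sym)

module RationalScaling where

  open import Data.Integer as ℤ using (+_; +[1+_]; -[1+_]; +≤+; +<+)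
  import Data.Integer.Properties as ℤ
  open import Data.Rational using (ℚ; mkℚ; 0ℚ)
  open import Data.Rational.Unnormalised as ℚᵘ using (mkℚᵘ; *≤*)
  import Data.Rational.Unnormalised.Properties as ℚᵘ
  open import Data.Nat.Coprimality using (Coprime; 1-coprimeTo) renaming (sym to coprime-sym)
  open import Function using (_⇔_; mk⇔)

  toℚᵘ-toℚ : ∀ a → ℚ.toℚᵘ (toℚ a) ≡ mkℚᵘ (+ a) 0
  toℚᵘ-toℚ a = cong ℚ.toℚᵘ (ℚ.normalize-coprime (coprime-sym (1-coprimeTo a)))

  toℚ-* : ∀ a b → toℚ (a ℕ.* b) ≡ toℚ a ℚ.* toℚ b
  toℚ-* a b = ℚ.toℚᵘ-injective (begin
    ℚ.toℚᵘ (toℚ (a ℕ.* b))          ≡⟨ toℚᵘ-toℚ (a ℕ.* b) ⟩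
    mkℚᵘ (+ (a ℕ.* b)) 0             ≈⟨ ℚᵘ.*≡* (cong (ℤ._* + 1) (ℤ.pos-* a b)) ⟩
    mkℚᵘ (+ a) 0 ℚᵘ.* mkℚᵘ (+ b) 0  ≡⟨ sym (cong₂ ℚᵘ._*_ (toℚᵘ-toℚ a) (toℚᵘ-toℚ b)) ⟩
    ℚ.toℚᵘ (toℚ a) ℚᵘ.* ℚ.toℚᵘ (toℚ b) ≈⟨ ℚᵘ.≃-sym (ℚ.toℚᵘ-homo-* (toℚ a) (toℚ b)) ⟩
    ℚ.toℚᵘ (toℚ a ℚ.* toℚ b) ∎)
    where open ℚᵘ.≃-Reasoning

  mkℚ*toℚ≤toℚ⇔ : ∀ k d .(c : Coprime k (suc d)) a b →
    mkℚ (+ k) d c ℚ.* toℚ a ℚ.≤ toℚ b ⇔ k ℕ.* a ℕ.≤ b ℕ.* suc d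
  mkℚ*toℚ≤toℚ⇔ k d c a b = mk⇔
    (λ le → toℕ-form (fromᵘ (ℚᵘ.≤-respˡ-≃ (ℚ.toℚᵘ-homo-* γ (toℚ a)) (ℚ.toℚᵘ-mono-≤ le))))
    (λ le → ℚ.toℚᵘ-cancel-≤
               (ℚᵘ.≤-respˡ-≃ (ℚᵘ.≃-sym (ℚ.toℚᵘ-homo-* γ (toℚ a))) (toᵘ (fromℕ-form le))))
    where
    γ = mkℚ (+ k) d c
    lhs : (+ k ℤ.* + a) ℤ.* + 1 ≡ + (k ℕ.* a)
    lhs = trans (ℤ.*-identityʳ _) (sym (ℤ.pos-* k a))
    rhs : + b ℤ.* + suc (d ℕ.* 1) ≡ + (b ℕ.* suc d)
    rhs = trans (sym (ℤ.pos-* b _)) (cong (λ t → + (b ℕ.* suc t)) (ℕ.*-identityʳ d))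
    fromᵘ : ℚ.toℚᵘ γ ℚᵘ.* ℚ.toℚᵘ (toℚ a) ℚᵘ.≤ ℚ.toℚᵘ (toℚ b) →
            (+ k ℤ.* + a) ℤ.* + 1 ℤ.≤ + b ℤ.* + suc (d ℕ.* 1)
    fromᵘ le with ℚ.toℚᵘ (toℚ a) | toℚᵘ-toℚ a | ℚ.toℚᵘ (toℚ b) | toℚᵘ-toℚ b | le
    ... | _ | refl | _ | refl | *≤* z = z
    toᵘ : (+ k ℤ.* + a) ℤ.* + 1 ℤ.≤ + b ℤ.* + suc (d ℕ.* 1) →
          ℚ.toℚᵘ γ ℚᵘ.* ℚ.toℚᵘ (toℚ a) ℚᵘ.≤ ℚ.toℚᵘ (toℚ b)
    toᵘ z rewrite toℚᵘ-toℚ a | toℚᵘ-toℚ b = *≤* z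
    toℕ-form : (+ k ℤ.* + a) ℤ.* + 1 ℤ.≤ + b ℤ.* + suc (d ℕ.* 1) → k ℕ.* a ℕ.≤ b ℕ.* suc d
    toℕ-form z = ℤ.drop‿+≤+ (subst₂ ℤ._≤_ lhs rhs z)
    fromℕ-form : k ℕ.* a ℕ.≤ b ℕ.* suc d → (+ k ℤ.* + a) ℤ.* + 1 ℤ.≤ + b ℤ.* + suc (d ℕ.* 1)
    fromℕ-form le = subst₂ ℤ._≤_ (sym lhs) (sym rhs) (+≤+ le)

  positive⇒scale-bound : ∀ γ → 0ℚ ℚ.< γ → ∃[ q ] ∀ a b → γ ℚ.* toℚ a ℚ.≤ toℚ b → a ℕ.≤ q ℕ.* b
  positive⇒scale-bound (mkℚ (+ 0)      d c) (ℚ.*<* (+<+ ()))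
  positive⇒scale-bound (mkℚ -[1+ _ ]   d c) (ℚ.*<* ())
  positive⇒scale-bound (mkℚ +[1+ k ] d c) _ = suc d , λ a b γa≤b → begin
    a                 ≤⟨ ℕ.m≤n*m a (suc k) ⟩
    suc k ℕ.* a       ≤⟨ Equivalence.to (mkℚ*toℚ≤toℚ⇔ (suc k) d c a b) γa≤b ⟩
    b ℕ.* suc d       ≡⟨ ℕ.*-comm b (suc d) ⟩
    suc d ℕ.* b ∎
    where open ℕ.≤-Reasoning

  1/suc : ℕ → ℚ
  1/suc k = mkℚ (+ 1) k (1-coprimeTo (suc k))

  1/suc-positive : ∀ k → 0ℚ ℚ.< 1/suc k
  1/suc-positive k = ℚ.*<* (+<+ (s≤s z≤n))

  1/suc*toℚ≤toℚ : ∀ k a b → a ℕ.≤ suc k ℕ.* b → 1/suc k ℚ.* toℚ a ℚ.≤ toℚ b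
  1/suc*toℚ≤toℚ k a b a≤ = Equivalence.from (mkℚ*toℚ≤toℚ⇔ 1 k (1-coprimeTo (suc k)) a b)
    (subst₂ ℕ._≤_ (sym (ℕ.*-identityˡ a)) (ℕ.*-comm (suc k) b) a≤)

module FiniteSums where

  open Data.Nat using (_*_)
  open import Algebra.Properties.CommutativeMonoid.Sum ℕ.+-0-commutativeMonoid using (sum; sum-remove; sum-permute)

  Σ-cong : ∀ {n} {f g : Fin n → ℕ} → (∀ i → f i ≡ g i) → Σ[< n ] f ≡ Σ[< n ] g
  Σ-cong {zero}  f≗g = refl
  Σ-cong {suc n} f≗g = cong₂ _+_ (f≗g zero) (Σ-cong (f≗g ∘ suc))

  Σ-mono-≤ : ∀ {n} {f g : Fin n → ℕ} → (∀ i → f i ≤ g i) → Σ[< n ] f ≤ Σ[< n ] g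
  Σ-mono-≤ {zero}  f≤g = z≤n
  Σ-mono-≤ {suc n} f≤g = ℕ.+-mono-≤ (f≤g zero) (Σ-mono-≤ (f≤g ∘ suc))

  Σ-distrib-+ : ∀ {n} (f g : Fin n → ℕ) → Σ[< n ] (λ i → f i + g i) ≡ Σ[< n ] f + Σ[< n ] g
  Σ-distrib-+ {zero}  f g = refl
  Σ-distrib-+ {suc n} f g = begin
    (f zero + g zero) + Σ[< n ] (λ i → f (suc i) + g (suc i))
      ≡⟨ cong ((f zero + g zero) +_) (Σ-distrib-+ (f ∘ suc) (g ∘ suc)) ⟩
    (f zero + g zero) + (Σ[< n ] (f ∘ suc) + Σ[< n ] (g ∘ suc))
      ≡⟨ +-interchange (f zero) (g zero) _ _ ⟩
    (f zero + Σ[< n ] (f ∘ suc)) + (g zero + Σ[< n ] (g ∘ suc)) ∎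
    where
    open ≡-Reasoning
    open +-*-Solver
    +-interchange : ∀ a b c d → (a + b) + (c + d) ≡ (a + c) + (b + d)
    +-interchange = solve 4 (λ a b c d → (a :+ b) :+ (c :+ d) := (a :+ c) :+ (b :+ d)) refl

  Σ-*ˡ : ∀ {n} c (f : Fin n → ℕ) → Σ[< n ] (λ i → c * f i) ≡ c * Σ[< n ] f
  Σ-*ˡ {zero}  c f = sym (ℕ.*-zeroʳ c)
  Σ-*ˡ {suc n} c f = trans (cong (c * f zero +_) (Σ-*ˡ c (f ∘ suc))) (sym (ℕ.*-distribˡ-+ c (f zero) _))

  Σ-const : ∀ n c → Σ[< n ] (λ _ → c) ≡ n * c
  Σ-const zero    c = refl
  Σ-const (suc n) c = cong (c +_) (Σ-const n c)

  Σ-comm : ∀ {n m} (f : Fin n → Fin m → ℕ) →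
    Σ[< n ] (λ i → Σ[< m ] (f i)) ≡ Σ[< m ] (λ j → Σ[< n ] (λ i → f i j))
  Σ-comm {zero}  {m} f = sym (trans (Σ-const m 0) (ℕ.*-zeroʳ m))
  Σ-comm {suc n} {m} f =
    trans (cong (Σ[< m ] (f zero) +_) (Σ-comm (f ∘ suc))) (sym (Σ-distrib-+ (f zero) _))

  ≤-Σ : ∀ {n} (f : Fin n → ℕ) i → f i ≤ Σ[< n ] f
  ≤-Σ f zero    = ℕ.m≤m+n _ _
  ≤-Σ f (suc i) = ℕ.≤-trans (≤-Σ (f ∘ suc) i) (ℕ.m≤n+m _ (f zero))

  Σ≡sum : ∀ {n} (f : Fin n → ℕ) → Σ[< n ] f ≡ sum f
  Σ≡sum {zero}  f = refl
  Σ≡sum {suc n} f = cong (f zero +_) (Σ≡sum (f ∘ suc))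

  Σ-removeAt : ∀ {n} (f : Fin (suc n) → ℕ) i → Σ[< suc n ] f ≡ f i + Σ[< n ] (f ∘ punchIn i)
  Σ-removeAt f i =
    trans (Σ≡sum f) (trans (sum-remove f) (cong (f i +_) (sym (Σ≡sum (f ∘ punchIn i)))))

  Σ-permute : ∀ {n} (f : Fin n → ℕ) (π : Permutation′ n) → Σ[< n ] f ≡ Σ[< n ] (λ i → f (π ⟨$⟩ʳ i))
  Σ-permute f π = trans (Σ≡sum f) (trans (sum-permute f π) (sym (Σ≡sum (λ i → f (π ⟨$⟩ʳ i)))))

  +-≤-Σ : ∀ {n} (f : Fin n → ℕ) {i j} → ¬ i ≡ j → f i + f j ≤ Σ[< n ] f
  +-≤-Σ {suc n} f {i} {j} i≢j = subst (f i + f j ≤_) (sym (Σ-removeAt f i))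
    (ℕ.+-monoʳ-≤ (f i) (subst (λ t → f t ≤ Σ[< n ] (f ∘ punchIn i))
      (Fin.punchIn-punchOut i≢j) (≤-Σ (f ∘ punchIn i) (Fin.punchOut i≢j))))

  Σ-++ : ∀ a b (f : Fin (a + b) → ℕ) →
    Σ[< a + b ] f ≡ Σ[< a ] (λ i → f (i ↑ˡ b)) + Σ[< b ] (λ j → f (a ↑ʳ j))
  Σ-++ zero    b f = refl
  Σ-++ (suc a) b f = trans (cong (f zero +_) (Σ-++ a b (f ∘ suc))) (sym (ℕ.+-assoc (f zero) _ _))

  Σ-combine : ∀ n m (f : Fin (n * m) → ℕ) →
    Σ[< n * m ] f ≡ Σ[< n ] (λ v → Σ[< m ] (λ i → f (combine v i)))
  Σ-combine zero    m f = refl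
  Σ-combine (suc n) m f =
    trans (Σ-++ m (n * m) f) (cong (Σ[< m ] (λ i → f (combine {suc n} zero i)) +_) (Σ-combine n m (f ∘ (m ↑ʳ_))))

module Indicators where

  open Data.Nat using (_*_)
  open FiniteSums

  ind : Bool → ℕ
  ind b = if b then 1 else 0

  ind≤1 : ∀ b → ind b ≤ 1
  ind≤1 true  = ℕ.≤-refl
  ind≤1 false = z≤n

  ind-not+ind : ∀ b → ind (not b) + ind b ≡ 1
  ind-not+ind true  = refl
  ind-not+ind false = refl

  count-not+count : ∀ {m} (g : Fin m → Bool) → count (not ∘ g) + count g ≡ m
  count-not+count {m} g = begin
    count (not ∘ g) + count g               ≡⟨ Σ-distrib-+ (ind ∘ not ∘ g) (ind ∘ g) ⟨
    Σ[< m ] (λ a → ind (not (g a)) + ind (g a)) ≡⟨ Σ-cong (ind-not+ind ∘ g) ⟩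
    Σ[< m ] (λ _ → 1)                       ≡⟨ Σ-const m 1 ⟩
    m * 1                                   ≡⟨ ℕ.*-identityʳ m ⟩
    m ∎
    where open ≡-Reasoning

  ind-anyF≤count : ∀ {n} (q : Fin n → Bool) → ind (anyF q) ≤ count q
  ind-anyF≤count {zero}  q = z≤n
  ind-anyF≤count {suc n} q with q zero
  ... | true  = s≤s z≤n
  ... | false = ind-anyF≤count (q ∘ suc)

  ==-refl : ∀ {n} (x : Fin n) → (x == x) ≡ true
  ==-refl x with x ≟ x
  ... | yes _  = refl
  ... | no x≢x = ⊥-elim (x≢x refl)

  ≢⇒==-false : ∀ {n} {x y : Fin n} → ¬ x ≡ y → (x == y) ≡ false
  ≢⇒==-false {x = x} {y} x≢y with x ≟ y
  ... | yes x≡y = ⊥-elim (x≢y x≡y)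
  ... | no _    = refl

  ==-sym : ∀ {n} (x y : Fin n) → (x == y) ≡ (y == x)
  ==-sym x y with x ≟ y | y ≟ x
  ... | yes _   | yes _   = refl
  ... | no _    | no _    = refl
  ... | yes x≡y | no y≢x  = ⊥-elim (y≢x (sym x≡y))
  ... | no x≢y  | yes y≡x = ⊥-elim (x≢y (sym y≡x))

  count-== : ∀ {n} (c : Fin n) → count (c ==_) ≡ 1
  count-== {suc n} c = begin
    count (c ==_)                                  ≡⟨ Σ-removeAt (ind ∘ (c ==_)) c ⟩
    ind (c == c) + Σ[< n ] (λ i → ind (c == Fin.punchIn c i))
      ≡⟨ cong₂ _+_ (cong ind (==-refl c)) (Σ-cong λ i → cong ind (≢⇒==-false (Fin.punchInᵢ≢i c i ∘ sym))) ⟩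
    1 + Σ[< n ] (λ _ → 0)                          ≡⟨ cong suc (trans (Σ-const n 0) (ℕ.*-zeroʳ n)) ⟩
    1 ∎
    where open ≡-Reasoning

  Σ-select : ∀ {n} (c : Fin n) (k : ℕ) → Σ[< n ] (λ w → ind (c == w) * k) ≡ k
  Σ-select {n} c k = begin
    Σ[< n ] (λ w → ind (c == w) * k) ≡⟨ Σ-cong (λ w → ℕ.*-comm (ind (c == w)) k) ⟩
    Σ[< n ] (λ w → k * ind (c == w)) ≡⟨ Σ-*ˡ k (ind ∘ (c ==_)) ⟩
    k * count (c ==_)                ≡⟨ cong (k *_) (count-== c) ⟩
    k * 1                            ≡⟨ ℕ.*-identityʳ k ⟩
    k ∎
    where open ≡-Reasoning

  Σ² : ∀ {n} → (Fin n → Fin n → ℕ) → ℕ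
  Σ² {n} g = Σ[< n ] λ x → Σ[< n ] (g x)

  upper : ∀ {n} → (Fin n → Fin n → ℕ) → Fin n → Fin n → ℕ
  upper g x y = if x ≤ᵇF y then g x y else 0

  Σ²-symmetric≤2*Σ²-upper : ∀ {n} (g : Fin n → Fin n → ℕ) → (∀ x y → g x y ≡ g y x) →
    Σ² g ≤ 2 * Σ² (upper g)
  Σ²-symmetric≤2*Σ²-upper {n} g g-sym = begin
    Σ² g                                         ≤⟨ Σ-mono-≤ (λ x → Σ-mono-≤ (split x)) ⟩
    Σ² (λ x y → upper g x y + upper g y x)        ≡⟨ Σ-cong (λ x → Σ-distrib-+ (upper g x) _) ⟩
    Σ[< n ] (λ x → Σ[< n ] (upper g x) + Σ[< n ] (λ y → upper g y x))
      ≡⟨ Σ-distrib-+ (λ x → Σ[< n ] (upper g x)) (λ x → Σ[< n ] (λ y → upper g y x)) ⟩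
    Σ² (upper g) + Σ² (λ x y → upper g y x)       ≡⟨ cong (Σ² (upper g) +_) (Σ-comm (λ x y → upper g y x)) ⟩
    Σ² (upper g) + Σ² (upper g)                   ≡⟨ cong (Σ² (upper g) +_) (ℕ.+-identityʳ _) ⟨
    2 * Σ² (upper g) ∎
    where
    open ℕ.≤-Reasoning
    ≤ᵇ-total : ∀ a b → (a ℕ.≤ᵇ b) ≡ false → (b ℕ.≤ᵇ a) ≡ true
    ≤ᵇ-total a b a≰b with ℕ.≤-total b a
    ... | inj₁ b≤a = Equivalence.to Bool.T-≡ (ℕ.≤⇒≤ᵇ b≤a)
    ... | inj₂ a≤b = ⊥-elim (subst T a≰b (ℕ.≤⇒≤ᵇ a≤b))
    split : ∀ x y → g x y ≤ upper g x y + upper g y x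
    split x y with x ≤ᵇF y in x≤y
    ... | true  = ℕ.m≤m+n (g x y) _
    ... | false rewrite ≤ᵇ-total (toℕ x) (toℕ y) x≤y = ℕ.≤-reflexive (g-sym x y)

  1≤⇒ind≤ : ∀ {b k} → 1 ≤ k → ind b ≤ k
  1≤⇒ind≤ {b} = ℕ.≤-trans (ind≤1 b)

  1≤ind-≢ : ∀ {n} {a b : Fin n} → a ≢ b → 1 ≤ ind (not (a == b))
  1≤ind-≢ a≢b rewrite ≢⇒==-false a≢b = ℕ.≤-refl

  ≢-via : ∀ {n} {a c : Fin n} b → a ≢ c → 1 ≤ ind (not (b == c)) + ind (not (a == b))
  ≢-via {a = a} {c} b a≢c with b ≟ c
  ... | no _     = s≤s z≤n
  ... | yes refl = 1≤ind-≢ a≢c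

  ==-false⇒≢ : ∀ {n} {a b : Fin n} → (a == b) ≡ false → a ≢ b
  ==-false⇒≢ {a = a} a≠b refl with () ← trans (sym a≠b) (==-refl a)

  ind-∧-not≤ : ∀ A b {k} → (b ≡ false → ind A ≤ k) → ind (A ∧ not b) ≤ k
  ind-∧-not≤ A     false bound = subst (_≤ _) (cong ind (sym (Bool.∧-identityʳ A))) (bound refl)
  ind-∧-not≤ false true  bound = z≤n
  ind-∧-not≤ true  true  bound = z≤n

module Permutations where

  open import Data.Fin.Permutation using (_∘ₚ_; transpose)
  open import Data.List using (List; []; _∷_; allFin)
  open import Data.List.Membership.Propositional using (_∈_)
  open import Data.List.Membership.Propositional.Properties using (∈-allFin)
  open import Data.List.Relation.Unary.Any using (here; there)
  import Data.Maybe.Properties as Maybe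
  open FiniteSums
  open Indicators

  transpose-matchˡ : ∀ {n} (i j : Fin n) → transpose i j ⟨$⟩ʳ i ≡ j
  transpose-matchˡ i j with i ≟ i
  ... | yes _  = refl
  ... | no i≢i = ⊥-elim (i≢i refl)

  transpose-fix : ∀ {n} {i j k : Fin n} → k ≢ i → k ≢ j → transpose i j ⟨$⟩ʳ k ≡ k
  transpose-fix {i = i} {j} {k} k≢i k≢j with k ≟ i
  ... | yes k≡i = ⊥-elim (k≢i k≡i)
  ... | no _ with k ≟ j
  ...   | yes k≡j = ⊥-elim (k≢j k≡j)
  ...   | no _    = refl

  ⟨$⟩ʳ-injective : ∀ {n} (π : Permutation′ n) {x y} → π ⟨$⟩ʳ x ≡ π ⟨$⟩ʳ y → x ≡ y
  ⟨$⟩ʳ-injective π {x} {y} πx≡πy =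
    trans (sym (Perm.inverseˡ π)) (trans (cong (π ⟨$⟩ˡ_) πx≡πy) (Perm.inverseˡ π))

  PartialInjection : ∀ {n} → (Fin n → Maybe (Fin n)) → Set
  PartialInjection f = ∀ {v v′ w} → f v ≡ just w → f v′ ≡ just w → v ≡ v′

  module _ {n} (f : Fin n → Maybe (Fin n)) (f-inj : PartialInjection f) where

    private
      extend-on : (vs : List (Fin n)) →
        ∃[ π ] ∀ {v w} → v ∈ vs → f v ≡ just w → π ⟨$⟩ʳ v ≡ w
      extend-on []       = Perm.id , λ ()
      extend-on (u ∷ us) with extend-on us | f u in fu
      ... | π , π-ext | nothing = π , ext
        where
        ext : ∀ {v w} → v ∈ u ∷ us → f v ≡ just w → π ⟨$⟩ʳ v ≡ w
        ext (here refl) fv with () ← trans (sym fu) fv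
        ext (there v∈us) fv = π-ext v∈us fv
      ... | π , π-ext | just w₀ = π ∘ₚ transpose (π ⟨$⟩ʳ u) w₀ , ext
        where
        ext : ∀ {v w} → v ∈ u ∷ us → f v ≡ just w → transpose (π ⟨$⟩ʳ u) w₀ ⟨$⟩ʳ (π ⟨$⟩ʳ v) ≡ w
        ext {v} (here refl) fv = trans (transpose-matchˡ (π ⟨$⟩ʳ u) w₀) (Maybe.just-injective (trans (sym fu) fv))
        ext {v} (there v∈us) fv with v ≟ u
        ... | yes refl = trans (transpose-matchˡ (π ⟨$⟩ʳ u) w₀) (Maybe.just-injective (trans (sym fu) fv))
        ... | no v≢u = trans (cong (transpose (π ⟨$⟩ʳ u) w₀ ⟨$⟩ʳ_) πv≡w)
                         (transpose-fix (λ w≡πu → v≢u (⟨$⟩ʳ-injective π (trans πv≡w w≡πu)))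
                                        (λ { refl → v≢u (f-inj fv fu) }))
          where πv≡w = π-ext v∈us fv

    extend-partialInjection : ∃[ π ] ∀ {v w} → f v ≡ just w → π ⟨$⟩ʳ v ≡ w
    extend-partialInjection with extend-on (allFin n)
    ... | π , π-ext = π , λ {v} → π-ext (∈-allFin v)

  ⟨$⟩ʳ-fixed≡⟨$⟩ˡ-fixed : ∀ {n} (π : Permutation′ n) x → ((π ⟨$⟩ʳ x) == x) ≡ ((π ⟨$⟩ˡ x) == x)
  ⟨$⟩ʳ-fixed≡⟨$⟩ˡ-fixed π x with π ⟨$⟩ʳ x ≟ x | π ⟨$⟩ˡ x ≟ x
  ... | yes _   | yes _   = refl
  ... | no _    | no _    = refl
  ... | yes πx≡x | no π⁻¹x≢x = ⊥-elim (π⁻¹x≢x (trans (cong (π ⟨$⟩ˡ_) (sym πx≡x)) (Perm.inverseˡ π)))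
  ... | no πx≢x | yes π⁻¹x≡x = ⊥-elim (πx≢x (trans (cong (π ⟨$⟩ʳ_) (sym π⁻¹x≡x)) (Perm.inverseʳ π)))

  moved-flip : ∀ {n} (π : Permutation′ n) → moved (Perm.flip π) ≡ moved π
  moved-flip π = Σ-cong λ x → cong (λ b → if not b then 1 else 0) (sym (⟨$⟩ʳ-fixed≡⟨$⟩ˡ-fixed π x))

module Expanders where

  open Data.Nat using (_*_; _<_)
  open import Data.Fin.Subset using (Subset; ∣_∣)
  open import Data.Vec using (tabulate)
  import Data.Vec.Properties as Vec
  import Data.Sum as Sum
  open FiniteSums
  open Indicators

  -- β-expansion for β = 1/r, cleared of denominators.
  Expanding⁻¹ : ∀ {m} → ℕ → Graph m → Set
  Expanding⁻¹ {m} r H = ∀ (S : Subset m) → 2 * ∣ S ∣ ≤ m → ∣ S ∣ ≤ r * outNeighbours H S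

  edgesLeaving : ∀ {m} → Graph m → (Fin m → Bool) → ℕ
  edgesLeaving H f = Σ² λ a b → ind (f a ∧ adj H a b ∧ not (f b))

  ∣tabulate∣ : ∀ {m} (f : Fin m → Bool) → ∣ tabulate f ∣ ≡ count f
  ∣tabulate∣ {zero}  f = refl
  ∣tabulate∣ {suc m} f with f zero
  ... | true  = cong suc (∣tabulate∣ (f ∘ suc))
  ... | false = ∣tabulate∣ (f ∘ suc)

  outNeighbours≤edgesLeaving : ∀ {m} (H : Graph m) (f : Fin m → Bool) →
    outNeighbours H (tabulate f) ≤ edgesLeaving H f
  outNeighbours≤edgesLeaving {m} H f = begin
    outNeighbours H (tabulate f)
      ≡⟨ Σ-cong (λ b → cong₂ (λ x y → ind (not x ∧ y)) (Vec.lookup∘tabulate f b)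
           (anyF-cong (λ a → cong (_∧ adj H a b) (Vec.lookup∘tabulate f a)))) ⟩
    Σ[< m ] (λ b → ind (not (f b) ∧ anyF (λ a → f a ∧ adj H a b)))
      ≤⟨ Σ-mono-≤ entering≤ ⟩
    Σ[< m ] (λ b → Σ[< m ] λ a → ind (f a ∧ adj H a b ∧ not (f b)))
      ≡⟨ Σ-comm (λ b a → ind (f a ∧ adj H a b ∧ not (f b))) ⟩
    edgesLeaving H f ∎
    where
    open ℕ.≤-Reasoning
    anyF-cong : ∀ {n} {p q : Fin n → Bool} → (∀ i → p i ≡ q i) → anyF p ≡ anyF q
    anyF-cong {zero}  p≗q = refl
    anyF-cong {suc n} p≗q = cong₂ _∨_ (p≗q zero) (anyF-cong (p≗q ∘ suc))
    entering≤ : ∀ b → ind (not (f b) ∧ anyF (λ a → f a ∧ adj H a b)) ≤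
                      Σ[< m ] (λ a → ind (f a ∧ adj H a b ∧ not (f b)))
    entering≤ b with f b
    ... | true  = z≤n
    ... | false = ℕ.≤-trans (ind-anyF≤count (λ a → f a ∧ adj H a b))
                    (ℕ.≤-reflexive (Σ-cong (λ a → cong (ind ∘ (f a ∧_)) (sym (Bool.∧-identityʳ (adj H a b))))))

  no-two-majorities : ∀ a b {m} → a + b ≤ m → m < 2 * a → m < 2 * b → ⊥
  no-two-majorities a b {m} a+b≤m m<2a m<2b = ℕ.<-irrefl refl (begin-strict
    m + m         <⟨ ℕ.+-mono-< m<2a m<2b ⟩
    2 * a + 2 * b ≡⟨ ℕ.*-distribˡ-+ 2 a b ⟨
    2 * (a + b)   ≤⟨ ℕ.*-monoʳ-≤ 2 a+b≤m ⟩
    2 * m         ≡⟨ cong (m +_) (ℕ.+-identityʳ m) ⟩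
    m + m ∎)
    where open ℕ.≤-Reasoning

  small≤edgesLeaving : ∀ {m} (H : Graph m) r → Expanding⁻¹ r H → (f : Fin m → Bool) →
    2 * count f ≤ m → count f ≤ r * edgesLeaving H f
  small≤edgesLeaving {m} H r expanding f small = begin
    count f                                 ≡⟨ ∣tabulate∣ f ⟨
    ∣ tabulate f ∣
      ≤⟨ expanding (tabulate f) (subst (λ k → 2 * k ≤ m) (sym (∣tabulate∣ f)) small) ⟩
    r * outNeighbours H (tabulate f)        ≤⟨ ℕ.*-monoʳ-≤ r (outNeighbours≤edgesLeaving H f) ⟩
    r * edgesLeaving H f ∎
    where open ℕ.≤-Reasoning

  labelled : ∀ {m k} → (Fin m → Fin k) → Fin k → Fin m → Bool
  labelled L w a = L a == w

  NoMajority : ∀ {m k} → (Fin m → Fin k) → Set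
  NoMajority {m} L = ∀ w → 2 * count (labelled L w) ≤ m

  Plurality : ∀ {m k} → (Fin m → Fin k) → Fin k → Set
  Plurality {m} L w = m < 2 * count (labelled L w) ⊎ NoMajority L

  cut : ∀ {m k} → Graph m → (Fin m → Fin k) → ℕ
  cut H L = Σ² λ a b → ind (adj H a b ∧ not (L a == L b))

  module _ {m} (H : Graph m) (r : ℕ) (expanding : Expanding⁻¹ r H) where

    majority-disagreements≤cut : ∀ {k} (L : Fin m → Fin k) w → m < 2 * count (labelled L w) →
      count (not ∘ labelled L w) ≤ r * cut H L
    majority-disagreements≤cut L w majority = begin
      count (not ∘ labelled L w)                     ≤⟨ small≤edgesLeaving H r expanding _ minority ⟩
      r * edgesLeaving H (not ∘ labelled L w)        ≤⟨ ℕ.*-monoʳ-≤ r (Σ-mono-≤ λ a → Σ-mono-≤ (leaving⇒cut a)) ⟩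
      r * cut H L ∎
      where
      open ℕ.≤-Reasoning
      minority : 2 * count (not ∘ labelled L w) ≤ m
      minority = ℕ.≮⇒≥ λ m<2c → no-two-majorities (count (not ∘ labelled L w)) (count (labelled L w))
        (ℕ.≤-reflexive (count-not+count (labelled L w))) m<2c majority
      leaving⇒cut : ∀ a b → ind (not (L a == w) ∧ adj H a b ∧ not (not (L b == w))) ≤
                            ind (adj H a b ∧ not (L a == L b))
      leaving⇒cut a b with L a ≟ w | L b ≟ w | adj H a b
      ... | yes _   | _       | _     = z≤n
      ... | no _    | _       | false = z≤n
      ... | no _    | no _    | true  = z≤n
      ... | no La≢w | yes refl | true rewrite ≢⇒==-false La≢w = ℕ.≤-refl

    no-majority-disagreements≤cut : ∀ {k} (L : Fin m → Fin k) → NoMajority L →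
      ∀ w → count (not ∘ labelled L w) ≤ r * cut H L
    no-majority-disagreements≤cut {k} L no-majority w = begin
      count (not ∘ labelled L w)                          ≤⟨ count≤ (not ∘ labelled L w) ⟩
      m                                                   ≡⟨ Σ-count-labelled ⟨
      Σ[< k ] (λ w′ → count (labelled L w′))
        ≤⟨ Σ-mono-≤ (λ w′ → small≤edgesLeaving H r expanding _ (no-majority w′)) ⟩
      Σ[< k ] (λ w′ → r * edgesLeaving H (labelled L w′)) ≡⟨ Σ-*ˡ r (edgesLeaving H ∘ labelled L) ⟩
      r * Σ[< k ] (λ w′ → edgesLeaving H (labelled L w′)) ≡⟨ cong (r *_) reorder ⟩
      r * Σ² (λ a b → Σ[< k ] (leaving a b))
        ≤⟨ ℕ.*-monoʳ-≤ r (Σ-mono-≤ λ a → Σ-mono-≤ (Σ-leaving≤cut a)) ⟩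
      r * cut H L ∎
      where
      open ℕ.≤-Reasoning
      leaving : Fin m → Fin m → Fin k → ℕ
      leaving a b w′ = ind (L a == w′ ∧ adj H a b ∧ not (L b == w′))
      count≤ : (f : Fin m → Bool) → count f ≤ m
      count≤ f = ℕ.≤-trans (Σ-mono-≤ (ind≤1 ∘ f)) (ℕ.≤-reflexive (trans (Σ-const m 1) (ℕ.*-identityʳ m)))
      Σ-count-labelled : Σ[< k ] (λ w′ → count (labelled L w′)) ≡ m
      Σ-count-labelled = begin-equality
        Σ[< k ] (λ w′ → Σ[< m ] (λ a → ind (L a == w′))) ≡⟨ Σ-comm (λ w′ a → ind (L a == w′)) ⟩
        Σ[< m ] (λ a → count (L a ==_))                 ≡⟨ Σ-cong (count-== ∘ L) ⟩
        Σ[< m ] (λ _ → 1)                               ≡⟨ trans (Σ-const m 1) (ℕ.*-identityʳ m) ⟩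
        m ∎
      reorder : Σ[< k ] (λ w′ → edgesLeaving H (labelled L w′)) ≡ Σ² (λ a b → Σ[< k ] (leaving a b))
      reorder = trans (Σ-comm (λ w′ a → Σ[< m ] λ b → leaving a b w′))
                      (Σ-cong λ a → Σ-comm (λ w′ b → leaving a b w′))
      Σ-leaving≤cut : ∀ a b → Σ[< k ] (leaving a b) ≤ ind (adj H a b ∧ not (L a == L b))
      Σ-leaving≤cut a b = ℕ.≤-trans (Σ-mono-≤ leaving≤) (ℕ.≤-reflexive (Σ-select (L a) _))
        where
        leaving≤ : ∀ w′ → leaving a b w′ ≤ ind (L a == w′) * ind (adj H a b ∧ not (L a == L b))
        leaving≤ w′ with L a ≟ w′
        ... | no _    = z≤n
        ... | yes refl rewrite ==-sym (L b) (L a) = ℕ.≤-reflexive (sym (ℕ.+-identityʳ _))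

    disagreements≤cut : ∀ {k} (L : Fin m → Fin k) w → Plurality L w → count (not ∘ labelled L w) ≤ r * cut H L
    disagreements≤cut L w (inj₁ majority)    = majority-disagreements≤cut L w majority
    disagreements≤cut L w (inj₂ no-majority) = no-majority-disagreements≤cut L no-majority w

  relabel : ∀ {m} → Permutation′ m → Graph m → Graph m
  relabel σ H = record
    { adj    = λ i j → adj H (σ ⟨$⟩ˡ i) (σ ⟨$⟩ˡ j)
    ; sym    = λ i j → Graph.sym H (σ ⟨$⟩ˡ i) (σ ⟨$⟩ˡ j)
    ; irrefl = λ i → Graph.irrefl H (σ ⟨$⟩ˡ i)
    }

  count-permute : ∀ {m} (σ : Permutation′ m) (f : Fin m → Bool) → count f ≡ count (f ∘ (σ ⟨$⟩ʳ_))
  count-permute σ f = Σ-permute (ind ∘ f) σ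

  cut-relabel : ∀ {m k} (σ : Permutation′ m) (H : Graph m) (L : Fin m → Fin k) →
    cut (relabel σ H) L ≡ cut H (L ∘ (σ ⟨$⟩ʳ_))
  cut-relabel {m} σ H L = trans (Σ-permute (λ i → Σ[< m ] (edge i)) σ)
    (Σ-cong λ a → trans (Σ-permute (edge (σ ⟨$⟩ʳ a)) σ)
      (Σ-cong λ b → cong₂ (λ i j → ind (adj H i j ∧ not (L (σ ⟨$⟩ʳ a) == L (σ ⟨$⟩ʳ b))))
                          (Perm.inverseˡ σ) (Perm.inverseˡ σ)))
    where
    edge : Fin m → Fin m → ℕ
    edge i j = ind (adj (relabel σ H) i j ∧ not (L i == L j))

  disagreements≤cut-relabel : ∀ {m k} (H : Graph m) r → Expanding⁻¹ r H → (σ : Permutation′ m)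
    (L : Fin m → Fin k) (w : Fin k) → Plurality L w → count (not ∘ labelled L w) ≤ r * cut (relabel σ H) L
  disagreements≤cut-relabel {m} H r expanding σ L w plurality =
    subst₂ (λ c d → c ≤ r * d) (sym (count-permute σ (not ∘ labelled L w))) (sym (cut-relabel σ H L))
      (disagreements≤cut H r expanding (L ∘ (σ ⟨$⟩ʳ_)) w (Sum.map majority′ no-majority′ plurality))
    where
    majority′ : m < 2 * count (labelled L w) → m < 2 * count (labelled (L ∘ (σ ⟨$⟩ʳ_)) w)
    majority′ = subst (λ c → m < 2 * c) (count-permute σ (labelled L w))
    no-majority′ : NoMajority L → NoMajority (L ∘ (σ ⟨$⟩ʳ_))
    no-majority′ no-majority w′ = subst (λ c → 2 * c ≤ m) (count-permute σ (labelled L w′)) (no-majority w′)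

  StrictMajority : ∀ {m k} → (Fin m → Fin k) → Set
  StrictMajority {m} L = ∃[ w ] m < 2 * count (labelled L w)

  strictMajority? : ∀ {m k} (L : Fin m → Fin k) → StrictMajority L ⊎ NoMajority L
  strictMajority? {m} L with Fin.any? (λ w → m ℕ.<? 2 * count (labelled L w))
  ... | yes majority = inj₁ majority
  ... | no ¬majority = inj₂ λ w → ℕ.≮⇒≥ λ m<2c → ¬majority (w , m<2c)

  majorityLabel : ∀ {m k} {L : Fin m → Fin k} → StrictMajority L ⊎ NoMajority L → Maybe (Fin k)
  majorityLabel (inj₁ (w , _)) = just w
  majorityLabel (inj₂ _)       = nothing

  majorityLabel-majority : ∀ {m k} {L : Fin m → Fin k} d {w} → majorityLabel {L = L} d ≡ just w →
    m < 2 * count (labelled L w)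
  majorityLabel-majority (inj₁ (w , majority)) refl = majority

module Construction (m : ℕ) (G : Graph (suc m)) (H : Graph m) (σ : Fin (suc m) → Permutation′ m) where

  open Data.Nat using (_*_; _<_)
  open FiniteSums
  open Indicators
  open Permutations
  open Expanders

  n N : ℕ
  n = suc m
  N = n * m

  ⟨_,_⟩ : Fin n → Fin m → Fin N
  ⟨ v , i ⟩ = combine v i

  home : Fin N → Fin n
  home = block n

  idx : Fin N → Fin m
  idx = index n

  away : Fin N → Fin n
  away = other n

  home-⟨⟩ : ∀ v i → home ⟨ v , i ⟩ ≡ v
  home-⟨⟩ v i = cong proj₁ (Fin.remQuot-combine {n} {m} v i)

  idx-⟨⟩ : ∀ v i → idx ⟨ v , i ⟩ ≡ i
  idx-⟨⟩ v i = cong proj₂ (Fin.remQuot-combine {n} {m} v i)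

  away-⟨⟩ : ∀ v i → away ⟨ v , i ⟩ ≡ punchIn v i
  away-⟨⟩ v i = cong₂ punchIn (home-⟨⟩ v i) (idx-⟨⟩ v i)

  ⟨home,idx⟩ : ∀ x → ⟨ home x , idx x ⟩ ≡ x
  ⟨home,idx⟩ = Fin.combine-remQuot {n} m

  away≢home : ∀ x → away x ≢ home x
  away≢home x = Fin.punchInᵢ≢i (home x) (idx x)

  home-away-injective : ∀ {x y} → home x ≡ home y → away x ≡ away y → x ≡ y
  home-away-injective {x} {y} hx≡hy ax≡ay = begin
    x                   ≡⟨ ⟨home,idx⟩ x ⟨
    ⟨ home x , idx x ⟩  ≡⟨ cong₂ ⟨_,_⟩ hx≡hy (Fin.punchIn-injective (home y) (idx x) (idx y)
                             (trans (cong (λ v → punchIn v (idx x)) (sym hx≡hy)) ax≡ay)) ⟩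
    ⟨ home y , idx y ⟩  ≡⟨ ⟨home,idx⟩ y ⟩
    y ∎
    where open ≡-Reasoning

  -- twin ⟨v,u⟩ = ⟨u,v⟩; the colour-0 and colour-2 edges of 𝔾 are exactly the pairs {x , twin x}.
  twin : Fin N → Fin N
  twin x = ⟨ away x , punchOut (away≢home x) ⟩

  home-twin : ∀ x → home (twin x) ≡ away x
  home-twin x = home-⟨⟩ (away x) _

  away-twin : ∀ x → away (twin x) ≡ home x
  away-twin x = trans (away-⟨⟩ (away x) _) (Fin.punchIn-punchOut (away≢home x))

  twin-involutive : ∀ x → twin (twin x) ≡ x
  twin-involutive x = home-away-injective (trans (home-twin (twin x)) (away-twin x))
                                          (trans (away-twin (twin x)) (home-twin x))

  twinPerm : Permutation′ N
  twinPerm = Perm.permutation twin twin (λ x → twin-involutive x) (λ x → twin-involutive x)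

  Σ-twin : ∀ f → Σ[< N ] (f ∘ twin) ≡ Σ[< N ] f
  Σ-twin f = sym (Σ-permute f twinPerm)

  Σ-home : ∀ f → Σ[< N ] (f ∘ home) ≡ m * Σ[< n ] f
  Σ-home f = begin
    Σ[< N ] (f ∘ home)                           ≡⟨ Σ-combine n m (f ∘ home) ⟩
    Σ[< n ] (λ v → Σ[< m ] (λ i → f (home ⟨ v , i ⟩))) ≡⟨ Σ-cong (λ v → Σ-cong (cong f ∘ home-⟨⟩ v)) ⟩
    Σ[< n ] (λ v → Σ[< m ] (λ _ → f v))          ≡⟨ Σ-cong (λ v → Σ-const m (f v)) ⟩
    Σ[< n ] (λ v → m * f v)                      ≡⟨ Σ-*ˡ m f ⟩
    m * Σ[< n ] f ∎
    where open ≡-Reasoning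

  Σ-home-away : ∀ (f : Fin n → Fin n → ℕ) →
    Σ[< N ] (λ x → f (home x) (away x)) ≡ Σ[< n ] (λ v → Σ[< m ] (λ i → f v (punchIn v i)))
  Σ-home-away f = trans (Σ-combine n m (λ x → f (home x) (away x)))
    (Σ-cong λ v → Σ-cong λ i → cong₂ f (home-⟨⟩ v i) (away-⟨⟩ v i))

  Σ-with-twin : ∀ (f g : Fin N → ℕ) → Σ[< N ] (λ x → f x + f (twin x) + g x) ≡ 2 * Σ[< N ] f + Σ[< N ] g
  Σ-with-twin f g = begin
    Σ[< N ] (λ x → f x + f (twin x) + g x)          ≡⟨ Σ-distrib-+ (λ x → f x + f (twin x)) g ⟩
    Σ[< N ] (λ x → f x + f (twin x)) + Σ[< N ] g    ≡⟨ cong (_+ Σ[< N ] g) (Σ-distrib-+ f (f ∘ twin)) ⟩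
    Σ[< N ] f + Σ[< N ] (f ∘ twin) + Σ[< N ] g
      ≡⟨ cong (λ t → Σ[< N ] f + t + Σ[< N ] g) (trans (Σ-twin f) (sym (ℕ.+-identityʳ _))) ⟩
    2 * Σ[< N ] f + Σ[< N ] g ∎
    where open ≡-Reasoning

  𝔾 : ColMultigraph 3 N
  𝔾 = G′ n G H σ

  crossed : Fin N → Fin N → Bool
  crossed x y = (away x == home y) ∧ (away y == home x)

  crossed-twin : ∀ x → crossed x (twin x) ≡ true
  crossed-twin x = trans (cong₂ (λ a b → (away x == a) ∧ (b == home x)) (home-twin x) (away-twin x))
                         (cong₂ _∧_ (==-refl (away x)) (==-refl (home x)))

  crossed-sym : ∀ x y → crossed x y ≡ crossed y x
  crossed-sym x y = Bool.∧-comm (away x == home y) (away y == home x)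

  mult-sym : ∀ c x y → mult 𝔾 c x y ≡ mult 𝔾 c y x
  mult-sym 0F x y = cong₂ (λ a b → ind (a ∧ not b)) (crossed-sym x y) (Graph.sym G (home x) (home y))
  mult-sym 1F x y = cong₂ (λ a b → ind (a ∧ b)) (==-sym (home x) (home y)) (Graph.sym H _ _)
  mult-sym 2F x y = cong₂ (λ a b → ind (a ∧ b)) (crossed-sym x y) (Graph.sym G (home x) (home y))

  multU≡mult : ∀ c x y → multU 𝔾 c x y ≡ mult 𝔾 c x y
  multU≡mult c x y with x ≤ᵇF y
  ... | true  = refl
  ... | false = mult-sym c y x

  mult₁-⟨⟩ : ∀ v i j → mult 𝔾 1F ⟨ v , i ⟩ ⟨ v , j ⟩ ≡ ind (adj (relabel (σ v) H) i j)
  mult₁-⟨⟩ v i j = begin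
    ind ((home ⟨ v , i ⟩ == home ⟨ v , j ⟩) ∧
         adj H (σ (home ⟨ v , i ⟩) ⟨$⟩ˡ idx ⟨ v , i ⟩) (σ (home ⟨ v , j ⟩) ⟨$⟩ˡ idx ⟨ v , j ⟩))
      ≡⟨ cong₂ (λ a b → ind ((a == b) ∧ adj H (σ a ⟨$⟩ˡ idx ⟨ v , i ⟩) (σ b ⟨$⟩ˡ idx ⟨ v , j ⟩)))
               (home-⟨⟩ v i) (home-⟨⟩ v j) ⟩
    ind ((v == v) ∧ adj H (σ v ⟨$⟩ˡ idx ⟨ v , i ⟩) (σ v ⟨$⟩ˡ idx ⟨ v , j ⟩))
      ≡⟨ cong₂ (λ a b → ind (a ∧ adj H (σ v ⟨$⟩ˡ b) (σ v ⟨$⟩ˡ idx ⟨ v , j ⟩))) (==-refl v) (idx-⟨⟩ v i) ⟩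
    ind (adj H (σ v ⟨$⟩ˡ i) (σ v ⟨$⟩ˡ idx ⟨ v , j ⟩))
      ≡⟨ cong (λ b → ind (adj H (σ v ⟨$⟩ˡ i) (σ v ⟨$⟩ˡ b))) (idx-⟨⟩ v j) ⟩
    ind (adj (relabel (σ v) H) i j) ∎
    where open ≡-Reasoning

  module Deviation (μ : Permutation′ N) where

    τ : Fin N → Fin N
    τ = μ ⟨$⟩ˡ_

    defect : Fin 3 → Fin N → Fin N → ℕ
    defect c x y = ∣ mult 𝔾 c x y - mult 𝔾 c (τ x) (τ y) ∣

    Δ : Fin 3 → ℕ
    Δ c = Σ² (defect c)

    Σ-Δ≤2*colSymDiff : Σ[< 3 ] Δ ≤ 2 * colSymDiff 𝔾 μ
    Σ-Δ≤2*colSymDiff = begin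
      Σ[< 3 ] Δ                                   ≤⟨ Σ-mono-≤ (λ c → Σ²-symmetric≤2*Σ²-upper (defect c) (defect-sym c)) ⟩
      Σ[< 3 ] (λ c → 2 * Σ² (upper (defect c)))   ≡⟨ Σ-*ˡ 2 (λ c → Σ² (upper (defect c))) ⟩
      2 * Σ[< 3 ] (λ c → Σ² (upper (defect c)))   ≡⟨ cong (2 *_) (Σ-cong λ c → Σ-cong λ x → Σ-cong λ y →
                                                       cong (λ d → if x ≤ᵇF y then d else 0) (sym (defectU c x y))) ⟩
      2 * colSymDiff 𝔾 μ ∎
      where
      open ℕ.≤-Reasoning
      defect-sym : ∀ c x y → defect c x y ≡ defect c y x
      defect-sym c x y = cong₂ ∣_-_∣ (mult-sym c x y) (mult-sym c (τ x) (τ y))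
      defectU : ∀ c x y → ∣ multU 𝔾 c x y - multU 𝔾 c (τ x) (τ y) ∣ ≡ defect c x y
      defectU c x y = cong₂ ∣_-_∣ (multU≡mult c x y) (multU≡mult c (τ x) (τ y))

    crossDefect : Fin N → ℕ
    crossDefect x = defect 0F x (twin x) + defect 2F x (twin x)

    Σ-crossDefect≤Δ : Σ[< N ] crossDefect ≤ Δ 0F + Δ 2F
    Σ-crossDefect≤Δ = ℕ.≤-trans (ℕ.≤-reflexive (Σ-distrib-+ (λ x → defect 0F x (twin x)) (λ x → defect 2F x (twin x))))
      (ℕ.+-mono-≤ (Σ-mono-≤ λ x → ≤-Σ (defect 0F x) (twin x)) (Σ-mono-≤ λ x → ≤-Σ (defect 2F x) (twin x)))

    twin-mismatch≤crossDefect : ∀ x →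
      ind (adj G (home x) (home (twin x)) ≠ᵇ adj G (home (τ x)) (home (τ (twin x)))) ≤ crossDefect x
    twin-mismatch≤crossDefect x =
      subst (λ c → ind (A ≠ᵇ B) ≤ ∣ ind (c ∧ not A) - ind (C ∧ not B) ∣ + ∣ ind (c ∧ A) - ind (C ∧ B) ∣)
            (sym (crossed-twin x)) (≠ᵇ≤ A B C)
      where
      A B C : Bool
      A = adj G (home x) (home (twin x))
      B = adj G (home (τ x)) (home (τ (twin x)))
      C = crossed (τ x) (τ (twin x))
      ≠ᵇ≤ : ∀ A B C → ind (A ≠ᵇ B) ≤ ∣ ind (not A) - ind (C ∧ not B) ∣ + ∣ ind A - ind (C ∧ B) ∣
      ≠ᵇ≤ false false C     = z≤n
      ≠ᵇ≤ true  true  C     = z≤n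
      ≠ᵇ≤ false true  false = s≤s z≤n
      ≠ᵇ≤ false true  true  = s≤s z≤n
      ≠ᵇ≤ true  false false = s≤s z≤n
      ≠ᵇ≤ true  false true  = s≤s z≤n

    displaced⇒crossDefect : ∀ x → home (τ x) ≡ home x → home (τ (twin x)) ≡ home (twin x) → τ x ≢ x →
      1 ≤ crossDefect x
    displaced⇒crossDefect x τx-home τx′-home τx≢x =
      subst₂ (λ c d → 1 ≤ ∣ ind (c ∧ not A) - ind (d ∧ not B) ∣ + ∣ ind (c ∧ A) - ind (d ∧ B) ∣)
             (sym (crossed-twin x)) (sym uncrossed)
             (ℕ.≤-reflexive (sym (trans (cong₂ _+_ (ℕ.∣-∣-identityʳ (ind (not A))) (ℕ.∣-∣-identityʳ (ind A)))
                                        (ind-not+ind A))))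
      where
      A B : Bool
      A = adj G (home x) (home (twin x))
      B = adj G (home (τ x)) (home (τ (twin x)))
      uncrossed : crossed (τ x) (τ (twin x)) ≡ false
      uncrossed with away (τ x) ≟ home (τ (twin x))
      ... | yes e = ⊥-elim (τx≢x (home-away-injective τx-home (trans e (trans τx′-home (home-twin x)))))
      ... | no _  = refl

    inner-defect : ∀ {x y} → home (τ x) ≢ home (τ y) → mult 𝔾 1F x y ≤ defect 1F x y
    inner-defect {x} {y} τx≢τy rewrite ≢⇒==-false τx≢τy = ℕ.≤-reflexive (sym (ℕ.∣-∣-identityʳ (mult 𝔾 1F x y)))

    label : Fin n → Fin m → Fin n
    label v i = home (τ ⟨ v , i ⟩)

    Σ-cut≤Δ₁ : Σ[< n ] (λ v → cut (relabel (σ v) H) (label v)) ≤ Δ 1F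
    Σ-cut≤Δ₁ = begin
      Σ[< n ] (λ v → cut (relabel (σ v) H) (label v))
        ≤⟨ Σ-mono-≤ (λ v → Σ-mono-≤ λ i → Σ-mono-≤ (cut-edge≤defect v i)) ⟩
      Σ[< n ] (λ v → Σ[< m ] λ i → Σ[< m ] λ j → defect 1F ⟨ v , i ⟩ ⟨ v , j ⟩)
        ≤⟨ Σ-mono-≤ (λ v → Σ-mono-≤ λ i → block≤Σ v (defect 1F ⟨ v , i ⟩)) ⟩
      Σ[< n ] (λ v → Σ[< m ] λ i → Σ[< N ] (defect 1F ⟨ v , i ⟩))
        ≡⟨ Σ-combine n m (λ x → Σ[< N ] (defect 1F x)) ⟨
      Δ 1F ∎
      where
      open ℕ.≤-Reasoning
      cut-edge≤defect : ∀ v i j → ind (adj (relabel (σ v) H) i j ∧ not (label v i == label v j)) ≤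
                                  defect 1F ⟨ v , i ⟩ ⟨ v , j ⟩
      cut-edge≤defect v i j = ind-∧-not≤ _ (label v i == label v j) λ labels≠ →
        subst (_≤ defect 1F ⟨ v , i ⟩ ⟨ v , j ⟩) (mult₁-⟨⟩ v i j) (inner-defect (==-false⇒≢ labels≠))
      block≤Σ : ∀ v (g : Fin N → ℕ) → Σ[< m ] (λ j → g ⟨ v , j ⟩) ≤ Σ[< N ] g
      block≤Σ v g = ℕ.≤-trans (≤-Σ (λ w → Σ[< m ] (λ j → g ⟨ w , j ⟩)) v)
                              (ℕ.≤-reflexive (sym (Σ-combine n m g)))

    Σ-count-label : ∀ w → Σ[< n ] (λ v → count (labelled (label v) w)) ≡ m
    Σ-count-label w = begin
      Σ[< n ] (λ v → Σ[< m ] (λ i → ind (home (τ ⟨ v , i ⟩) == w))) ≡⟨ Σ-combine n m (λ x → ind (home (τ x) == w)) ⟨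
      Σ[< N ] (λ x → ind (home (τ x) == w))                   ≡⟨ Σ-permute (λ x → ind (home x == w)) (Perm.flip μ) ⟨
      Σ[< N ] (λ x → ind (home x == w))                       ≡⟨ Σ-home (λ v → ind (v == w)) ⟩
      m * count (_== w)                                       ≡⟨ cong (m *_) (trans (Σ-cong λ v → cong ind (==-sym v w))
                                                                                        (count-== w)) ⟩
      m * 1                                                   ≡⟨ ℕ.*-identityʳ m ⟩
      m ∎
      where open ≡-Reasoning

    choice : Fin n → Maybe (Fin n)
    choice v = majorityLabel (strictMajority? (label v))

    choice-majority : ∀ {v w} → choice v ≡ just w → m < 2 * count (labelled (label v) w)
    choice-majority {v} = majorityLabel-majority (strictMajority? (label v))

    choice-injective : PartialInjection choice
    choice-injective {v} {v′} {w} cv cv′ with v ≟ v′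
    ... | yes v≡v′ = v≡v′
    ... | no v≢v′  = ⊥-elim (no-two-majorities (c v) (c v′) both≤m (choice-majority {v} cv) (choice-majority {v′} cv′))
      where
      c : Fin n → ℕ
      c u = count (labelled (label u) w)
      both≤m : c v + c v′ ≤ m
      both≤m = subst (c v + c v′ ≤_) (Σ-count-label w) (+-≤-Σ c v≢v′)

    extension-plurality : ∀ {ρ : Permutation′ n} → (∀ {v w} → choice v ≡ just w → ρ ⟨$⟩ʳ v ≡ w) →
      ∀ v → Plurality (label v) (ρ ⟨$⟩ʳ v)
    extension-plurality {ρ} extends v with strictMajority? (label v) in eq
    ... | inj₁ (w , majority) =
      inj₁ (subst (λ w′ → m < 2 * count (labelled (label v) w′)) (sym (extends (cong majorityLabel eq))) majority)
    ... | inj₂ no-majority    = inj₂ no-majority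

    module Comparison (ρ : Permutation′ n) where

      p : Fin n → Fin n
      p = ρ ⟨$⟩ʳ_

      misplaced : Fin N → ℕ
      misplaced x = ind (not (home (τ x) == p (home x)))

      stray : Fin N → ℕ
      stray x = ind (not (p (home x) == home x)) + misplaced x

      edge-mismatch≤ : ∀ x → ind (adj G (home x) (away x) ≠ᵇ adj G (p (home x)) (p (away x))) ≤
                             misplaced x + misplaced (twin x) + crossDefect x
      edge-mismatch≤ x = by-cases (home (τ x) ≟ p (home x)) (home (τ (twin x)) ≟ p (home (twin x)))
        where
        goal : Set
        goal = ind (adj G (home x) (away x) ≠ᵇ adj G (p (home x)) (p (away x))) ≤
               misplaced x + misplaced (twin x) + crossDefect x
        by-cases : Dec (home (τ x) ≡ p (home x)) → Dec (home (τ (twin x)) ≡ p (home (twin x))) → goal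
        by-cases (no τx≢) _ =
          1≤⇒ind≤ (ℕ.≤-trans (1≤ind-≢ τx≢) (ℕ.≤-trans (ℕ.m≤m+n _ (misplaced (twin x))) (ℕ.m≤m+n _ _)))
        by-cases (yes _) (no τx′≢) =
          1≤⇒ind≤ (ℕ.≤-trans (1≤ind-≢ τx′≢) (ℕ.≤-trans (ℕ.m≤n+m _ (misplaced x)) (ℕ.m≤m+n _ _)))
        by-cases (yes τx≡) (yes τx′≡) =
          ℕ.≤-trans (ℕ.≤-reflexive mismatch≡)
            (ℕ.≤-trans (twin-mismatch≤crossDefect x) (ℕ.m≤n+m _ (misplaced x + misplaced (twin x))))
          where
          mismatch≡ : ind (adj G (home x) (away x) ≠ᵇ adj G (p (home x)) (p (away x))) ≡
                      ind (adj G (home x) (home (twin x)) ≠ᵇ adj G (home (τ x)) (home (τ (twin x))))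
          mismatch≡ rewrite τx≡ | τx′≡ | home-twin x = refl

      moved-vertex≤ : ∀ x → ind (not (τ x == x)) ≤ stray x + stray (twin x) + crossDefect x
      moved-vertex≤ x = by-cases (τ x ≟ x) (home (τ x) ≟ home x) (home (τ (twin x)) ≟ home (twin x))
        where
        goal : Set
        goal = ind (not (τ x == x)) ≤ stray x + stray (twin x) + crossDefect x
        by-cases : Dec (τ x ≡ x) → Dec (home (τ x) ≡ home x) → Dec (home (τ (twin x)) ≡ home (twin x)) → goal
        by-cases (yes τx≡x) _ _ =
          ℕ.≤-trans (ℕ.≤-reflexive (cong (ind ∘ not) (trans (cong (_== x) τx≡x) (==-refl x)))) z≤n
        by-cases (no _) (no τx≢) _ =
          1≤⇒ind≤ (ℕ.≤-trans (≢-via (p (home x)) τx≢) (ℕ.≤-trans (ℕ.m≤m+n _ (stray (twin x))) (ℕ.m≤m+n _ _)))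
        by-cases (no _) (yes _) (no τx′≢) =
          1≤⇒ind≤ (ℕ.≤-trans (≢-via (p (home (twin x))) τx′≢) (ℕ.≤-trans (ℕ.m≤n+m _ (stray x)) (ℕ.m≤m+n _ _)))
        by-cases (no τx≢x) (yes τx≡) (yes τx′≡) =
          1≤⇒ind≤ (ℕ.≤-trans (displaced⇒crossDefect x τx≡ τx′≡ τx≢x) (ℕ.m≤n+m _ (stray x + stray (twin x))))

      symDiff-bound : symDiff G (Perm.flip ρ) ≤ 2 * Σ[< N ] misplaced + (Δ 0F + Δ 2F)
      symDiff-bound = begin
        symDiff G (Perm.flip ρ)
          ≤⟨ Σ-mono-≤ (λ u → Σ-mono-≤ λ w → drop-order (u <ᵇF w) (mismatch u w)) ⟩
        Σ[< n ] (λ u → Σ[< n ] (λ w → ind (mismatch u w)))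
          ≡⟨ Σ-cong (λ u → trans (Σ-removeAt (ind ∘ mismatch u) u)
                                 (cong (_+ Σ[< m ] (ind ∘ mismatch u ∘ punchIn u)) (no-loop-mismatch u))) ⟩
        Σ[< n ] (λ u → Σ[< m ] (λ i → ind (mismatch u (punchIn u i))))
          ≡⟨ Σ-home-away (λ u w → ind (mismatch u w)) ⟨
        Σ[< N ] (λ x → ind (mismatch (home x) (away x)))
          ≤⟨ Σ-mono-≤ edge-mismatch≤ ⟩
        Σ[< N ] (λ x → misplaced x + misplaced (twin x) + crossDefect x)
          ≡⟨ Σ-with-twin misplaced crossDefect ⟩
        2 * Σ[< N ] misplaced + Σ[< N ] crossDefect
          ≤⟨ ℕ.+-monoʳ-≤ (2 * Σ[< N ] misplaced) Σ-crossDefect≤Δ ⟩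
        2 * Σ[< N ] misplaced + (Δ 0F + Δ 2F) ∎
        where
        open ℕ.≤-Reasoning
        mismatch : Fin n → Fin n → Bool
        mismatch u w = adj G u w ≠ᵇ adj G (p u) (p w)
        drop-order : ∀ a b → (if a ∧ b then 1 else 0) ≤ ind b
        drop-order true  b = ℕ.≤-refl
        drop-order false b = z≤n
        no-loop-mismatch : ∀ u → ind (mismatch u u) ≡ 0
        no-loop-mismatch u = cong₂ (λ a b → ind (a ≠ᵇ b)) (Graph.irrefl G u) (Graph.irrefl G (p u))

      moved-bound : moved μ ≤ 2 * (m * moved ρ + Σ[< N ] misplaced) + (Δ 0F + Δ 2F)
      moved-bound = begin
        moved μ                                                   ≡⟨ moved-flip μ ⟨
        Σ[< N ] (λ x → ind (not (τ x == x)))                      ≤⟨ Σ-mono-≤ moved-vertex≤ ⟩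
        Σ[< N ] (λ x → stray x + stray (twin x) + crossDefect x)  ≡⟨ Σ-with-twin stray crossDefect ⟩
        2 * Σ[< N ] stray + Σ[< N ] crossDefect                   ≡⟨ cong (λ t → 2 * t + Σ[< N ] crossDefect) Σ-stray ⟩
        2 * (m * moved ρ + Σ[< N ] misplaced) + Σ[< N ] crossDefect ≤⟨ ℕ.+-monoʳ-≤ _ Σ-crossDefect≤Δ ⟩
        2 * (m * moved ρ + Σ[< N ] misplaced) + (Δ 0F + Δ 2F) ∎
        where
        open ℕ.≤-Reasoning
        Σ-stray : Σ[< N ] stray ≡ m * moved ρ + Σ[< N ] misplaced
        Σ-stray = trans (Σ-distrib-+ (λ x → ind (not (p (home x) == home x))) misplaced)
                        (cong (_+ Σ[< N ] misplaced) (Σ-home (λ v → ind (not (p v == v)))))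

      misplaced-bound : ∀ r → Expanding⁻¹ r H → (∀ v → Plurality (label v) (p v)) → Σ[< N ] misplaced ≤ r * Δ 1F
      misplaced-bound r expanding plurality = begin
        Σ[< N ] misplaced
          ≡⟨ Σ-combine n m misplaced ⟩
        Σ[< n ] (λ v → Σ[< m ] (λ i → misplaced ⟨ v , i ⟩))
          ≡⟨ Σ-cong (λ v → Σ-cong λ i → cong (λ u → ind (not (label v i == p u))) (home-⟨⟩ v i)) ⟩
        Σ[< n ] (λ v → count (not ∘ labelled (label v) (p v)))
          ≤⟨ Σ-mono-≤ (λ v → disagreements≤cut-relabel H r expanding (σ v) (label v) (p v) (plurality v)) ⟩
        Σ[< n ] (λ v → r * cut (relabel (σ v) H) (label v))
          ≡⟨ Σ-*ˡ r (λ v → cut (relabel (σ v) H) (label v)) ⟩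
        r * Σ[< n ] (λ v → cut (relabel (σ v) H) (label v))
          ≤⟨ ℕ.*-monoʳ-≤ r Σ-cut≤Δ₁ ⟩
        r * Δ 1F ∎
        where open ℕ.≤-Reasoning

  moved≤colSymDiff : ∀ q r → Expanding⁻¹ r H → (∀ ρ → n * moved ρ ≤ q * symDiff G ρ) →
    ∀ μ → moved μ ≤ 2 * (2 * q + 1) * (2 * r + 1) * colSymDiff 𝔾 μ
  moved≤colSymDiff q r expanding robust μ = begin
    moved μ                                    ≤⟨ moved-bound ⟩
    2 * (m * moved ρ + M) + (Δ 0F + Δ 2F)      ≡⟨ solve 4 (λ a b c d → con 2 :* (a :+ b) :+ (c :+ d)
                                                    := con 2 :* a :+ (con 2 :* b :+ (c :+ d))) refl (m * moved ρ) M (Δ 0F) (Δ 2F) ⟩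
    2 * (m * moved ρ) + Y                      ≤⟨ ℕ.+-monoˡ-≤ Y (ℕ.*-monoʳ-≤ 2 block-moves) ⟩
    2 * (q * Y) + Y                            ≡⟨ solve 2 (λ q y → con 2 :* (q :* y) :+ y := (con 2 :* q :+ con 1) :* y) refl q Y ⟩
    (2 * q + 1) * Y                            ≤⟨ ℕ.*-monoʳ-≤ (2 * q + 1) Y-bound ⟩
    (2 * q + 1) * ((2 * r + 1) * (2 * C))      ≡⟨ solve 3 (λ q r c → (con 2 :* q :+ con 1) :* ((con 2 :* r :+ con 1) :* (con 2 :* c))
                                                    := con 2 :* (con 2 :* q :+ con 1) :* (con 2 :* r :+ con 1) :* c) refl q r C ⟩
    2 * (2 * q + 1) * (2 * r + 1) * C ∎
    where
    open ℕ.≤-Reasoning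
    open +-*-Solver
    open Deviation μ
    extension : ∃[ ρ ] ∀ {v w} → choice v ≡ just w → ρ ⟨$⟩ʳ v ≡ w
    extension = extend-partialInjection choice choice-injective
    ρ : Permutation′ n
    ρ = proj₁ extension
    open Comparison ρ
    M Y C : ℕ
    M = Σ[< N ] misplaced
    Y = 2 * M + (Δ 0F + Δ 2F)
    C = colSymDiff 𝔾 μ
    block-moves : m * moved ρ ≤ q * Y
    block-moves = begin
      m * moved ρ                ≤⟨ ℕ.*-monoˡ-≤ (moved ρ) (ℕ.n≤1+n m) ⟩
      n * moved ρ                ≡⟨ cong (n *_) (moved-flip ρ) ⟨
      n * moved (Perm.flip ρ)    ≤⟨ robust (Perm.flip ρ) ⟩
      q * symDiff G (Perm.flip ρ) ≤⟨ ℕ.*-monoʳ-≤ q symDiff-bound ⟩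
      q * Y ∎
    Y-bound : Y ≤ (2 * r + 1) * (2 * C)
    Y-bound = begin
      2 * M + (Δ 0F + Δ 2F)
        ≤⟨ ℕ.+-monoˡ-≤ _ (ℕ.*-monoʳ-≤ 2 (misplaced-bound r expanding (extension-plurality {ρ} (proj₂ extension)))) ⟩
      2 * (r * Δ 1F) + (Δ 0F + Δ 2F)      ≤⟨ ℕ.m≤m+n _ (Δ 1F + 2 * r * (Δ 0F + Δ 2F)) ⟩
      2 * (r * Δ 1F) + (Δ 0F + Δ 2F) + (Δ 1F + 2 * r * (Δ 0F + Δ 2F))
                                          ≡⟨ solve 4 (λ r a b c → con 2 :* (r :* b) :+ (a :+ c) :+ (b :+ con 2 :* r :* (a :+ c))
                                               := (con 2 :* r :+ con 1) :* (a :+ (b :+ (c :+ con 0)))) refl r (Δ 0F) (Δ 1F) (Δ 2F) ⟩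
      (2 * r + 1) * Σ[< 3 ] Δ             ≤⟨ ℕ.*-monoʳ-≤ (2 * r + 1) Σ-Δ≤2*colSymDiff ⟩
      (2 * r + 1) * (2 * C) ∎

open import Data.Rational using (ℚ; 0ℚ; _<_; _*_)
open RationalScaling

proposition7p2 :
    (γ β : ℚ) (D : ℕ) → 0ℚ < γ → 0ℚ < β → 0 Data.Nat.< D →
    (P : ℕ → Set) (G : (n : ℕ) → Graph n) (H : (m : ℕ) → Graph m)
    (σ : (n : ℕ) → Fin n → Permutation′ (n ∸ 1)) →
    (∀ n → P n → RobustlySelfOrdered (γ * toℚ n) (G n)) →
    (∀ n → P n → Regular D (H (n ∸ 1)) × Expanding β (H (n ∸ 1))) →
    Σ ℚ (λ γ' → 0ℚ < γ' ×
      (∀ n → P n → ColRobustlySelfOrdered γ' (G′ n (G n) (H (n ∸ 1)) (σ n))))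
proposition7p2 γ β _ γ>0 β>0 _ P G H σ robust regular-expanding = 1/suc K , 1/suc-positive K , self-ordered
  where
  q r K : ℕ
  q = proj₁ (positive⇒scale-bound γ γ>0)
  r = proj₁ (positive⇒scale-bound β β>0)
  K = 2 ℕ.* (2 ℕ.* q ℕ.+ 1) ℕ.* (2 ℕ.* r ℕ.+ 1)
  self-ordered : ∀ n → P n → ColRobustlySelfOrdered (1/suc K) (G′ n (G n) (H (n ∸ 1)) (σ n))
  self-ordered zero    _  μ = 1/suc*toℚ≤toℚ K 0 0 z≤n
  self-ordered (suc m) Pn μ = 1/suc*toℚ≤toℚ K (moved μ) _
    (ℕ.≤-trans (Construction.moved≤colSymDiff m (G (suc m)) (H m) (σ (suc m)) q r expanding robust′ μ)
               (ℕ.*-monoˡ-≤ _ (ℕ.n≤1+n K)))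
    where
    expanding : Expanders.Expanding⁻¹ r (H m)
    expanding S small = proj₂ (positive⇒scale-bound β β>0) _ _ (proj₂ (regular-expanding (suc m) Pn) S small)
    robust′ : ∀ ρ → suc m ℕ.* moved ρ ℕ.≤ q ℕ.* symDiff (G (suc m)) ρ
    robust′ ρ = proj₂ (positive⇒scale-bound γ γ>0) _ _
      (subst (ℚ._≤ toℚ (symDiff (G (suc m)) ρ))
             (trans (ℚ.*-assoc γ _ _) (cong (γ *_) (sym (toℚ-* (suc m) (moved ρ)))))
             (robust (suc m) Pn ρ))
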